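{- Fix positive integers $s$ and $d$ with $s\ge 2$, let $T_1,\dots,T_d$ be trees, and let $G=T_1\,\Box\,\cdots\,\Box\,T_d$. Suppose a cop occupies a vertex $c$ and the robber occupies a vertex $r\neq c$ with $\operatorname{dist}_G(c,r)=x$, and the robber moves along a walk $r=r_0,r_1,\dots,r_s$ in which each $r_{i}$ is adjacent to and distinct from $r_{i-1}$ (i.e. he takes exactly $s$ steps). Let $m$ be the number of indices $i\in\{1,\dots,s\}$ with $\operatorname{dist}_G(c,r_i)<\operatorname{dist}_G(c,r_{i-1})$ (steps toward the cop). If $m<x/2$, then $\operatorname{dist}_G(c,r_s)>s$; that is, this cop cannot capture the robber on the ensuing cops' turn of the speed-$(s,s)$ game.
   Context: All graphs are finite and undirected; $\Box$ denotes the Cartesian product of graphs. In the speed-$(s,s)$ Cops and Robbers game each cop, on her turn, moves along a walk of length at most $s$, and captures the robber by landing on his vertex. -}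

module Defs where

open import Data.Nat using (ℕ; zero; suc; _+_; _≤_; _<ᵇ_)
open import Data.Bool using (if_then_else_)
open import Data.Fin using (Fin; zero; suc; inject₁; fromℕ)
open import Data.Product using (Σ; ∃; _×_)
open import Function using (_∘_)
open import Function.Definitions using (Injective)
open import Relation.Binary.PropositionalEquality using (_≡_; _≢_)
open import Relation.Nullary using (¬_)

data Walk {V : Set} (Adj : V → V → Set) : V → V → ℕ → Set where
  here : ∀ {u} → Walk Adj u u 0
  step : ∀ {u w v k} → Adj u w → Walk Adj w v k → Walk Adj u v (suc k)

IsDist : {V : Set} → (V → V → Set) → V → V → ℕ → Set
IsDist Adj u v k = Walk Adj u v k × (∀ j → Walk Adj u v j → k ≤ j)

record Graph : Set₁ where
  field
    n      : ℕ
    Adj    : Fin n → Fin n → Set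
    sym    : ∀ {u v} → Adj u v → Adj v u
    irrefl : ∀ {u} → ¬ Adj u u

open Graph public

Connected : Graph → Set
Connected G = ∀ u v → ∃ λ k → Walk (Adj G) u v k

record Cycle (G : Graph) : Set where
  field
    k     : ℕ
    f     : Fin (3 + k) → Fin (n G)
    inj   : Injective _≡_ _≡_ f
    edges : ∀ (i : Fin (2 + k)) → Adj G (f (inject₁ i)) (f (suc i))
    close : Adj G (f (fromℕ (2 + k))) (f zero)

Acyclic : Graph → Set
Acyclic G = ¬ Cycle G

IsTree : Graph → Set
IsTree G = (1 ≤ n G) × Connected G × Acyclic G

-- Cartesian product T 0 □ … □ T (d-1): vertices are tuples,
-- adjacent iff they differ in exactly one coordinate, where adjacent.
ProdV : (d : ℕ) → (Fin d → Graph) → Set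
ProdV d T = (i : Fin d) → Fin (n (T i))

ProdAdj : (d : ℕ) (T : Fin d → Graph) → ProdV d T → ProdV d T → Set
ProdAdj d T u v = Σ (Fin d) λ i → Adj (T i) (u i) (v i) × (∀ j → j ≢ i → u j ≡ v j)

towardCount : (s : ℕ) → (Fin (suc s) → ℕ) → ℕ
towardCount zero    D = 0
towardCount (suc s) D =
  (if D (suc zero) <ᵇ D zero then 1 else 0) + towardCount s (D ∘ suc)

{-# OPTIONS --safe #-}
-- Each tree is bipartite, since a shortest odd closed walk would be a cycle;
-- hence so is the product G, colouring a tuple by the sum of the colours of
-- its coordinates.  In a bipartite graph adjacent vertices lie at distances
-- of different parity from c, and at most one apart, so every robber step
-- changes the distance to the cop by exactly one.  With m steps towards the
-- cop the final distance is x + s - 2m, which exceeds s when 2m < x.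
module Submission where

open import Defs hiding (sym)
import Data.Parity.Properties as ℙ
open import Algebra.Properties.CommutativeMonoid.Sum ℙ.+-0-commutativeMonoid using (sum; sum-remove; sum-cong-≗)
open import Algebra.Properties.CommutativeSemigroup ℙ.+-commutativeSemigroup using (x∙yz≈y∙xz)
open import Data.Empty using (⊥-elim)
open import Data.Fin using (Fin; zero; suc; inject₁; fromℕ; fromℕ<; toℕ; punchIn; _≟_)
open import Data.Fin.Properties using (toℕ<n; toℕ-injective; toℕ-inject₁; toℕ-fromℕ; punchInᵢ≢i)
open import Data.Nat using (ℕ; zero; suc; _+_; _*_; _≤_; _<_; _<ᵇ_; s≤s; z≤n; parity)
open import Data.Nat.Induction using (<-rec)
open import Data.Nat.Properties
  using ( <-cmp; ≤-refl; ≤-antisym; <-≤-trans; m<n⇒m<1+n; m<m+n; m<n+m; m≤n+m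
        ; +-suc; +-assoc; +-comm; +-monoʳ-<; +-cancelˡ-<; anyUpTo?)
open import Data.Nat.Tactic.RingSolver using (solve-∀)
open import Data.Parity.Base using (Parity; 0ℙ; 1ℙ; _⁻¹) renaming (_+_ to _⊕_)
open import Data.Vec.Functional using (removeAt)
open import Data.Product using (Σ; ∃; ∃₂; _×_; _,_; proj₁; proj₂)
open import Data.Sum using (_⊎_; inj₁; inj₂)
open import Data.Bool using (true; false; if_then_else_)
open import Function using (_∘_)
open import Relation.Binary using (tri<; tri≈; tri>; Symmetric; DecidableEquality)
open import Relation.Binary.PropositionalEquality
  using (_≡_; _≢_; refl; sym; trans; cong; cong₂; subst; subst₂; module ≡-Reasoning)
open import Relation.Nullary using (¬_; Dec; yes; no)

open ≡-Reasoning

x⊕y⊕[y⊕z]≡x⊕z : ∀ x y z → (x ⊕ y) ⊕ (y ⊕ z) ≡ x ⊕ z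
x⊕y⊕[y⊕z]≡x⊕z x y z = begin
  (x ⊕ y) ⊕ (y ⊕ z)  ≡⟨ ℙ.+-assoc x y (y ⊕ z) ⟩
  x ⊕ (y ⊕ (y ⊕ z))  ≡⟨ cong (x ⊕_) (sym (ℙ.+-assoc y y z)) ⟩
  x ⊕ ((y ⊕ y) ⊕ z)  ≡⟨ cong (λ p → x ⊕ (p ⊕ z)) (ℙ.p+p≡0ℙ y) ⟩
  x ⊕ z              ∎

sum-differAt : ∀ {d} (f g : Fin d → Parity) i → f i ⊕ g i ≡ 1ℙ → (∀ j → j ≢ i → f j ≡ g j) →
               sum f ⊕ sum g ≡ 1ℙ
sum-differAt {suc d} f g i fᵢ⊕gᵢ≡1 same = begin
  sum f ⊕ sum g                   ≡⟨ cong₂ _⊕_ (sum-remove {i = i} f) (sum-remove {i = i} g) ⟩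
  (f i ⊕ rest f) ⊕ (g i ⊕ rest g) ≡⟨ cong (λ r → (f i ⊕ r) ⊕ (g i ⊕ rest g)) rest-same ⟩
  (f i ⊕ rest g) ⊕ (g i ⊕ rest g) ≡⟨ cong ((f i ⊕ rest g) ⊕_) (ℙ.+-comm (g i) (rest g)) ⟩
  (f i ⊕ rest g) ⊕ (rest g ⊕ g i) ≡⟨ x⊕y⊕[y⊕z]≡x⊕z (f i) (rest g) (g i) ⟩
  f i ⊕ g i                       ≡⟨ fᵢ⊕gᵢ≡1 ⟩
  1ℙ                              ∎
  where
  rest : (Fin (suc d) → Parity) → Parity
  rest h = sum (removeAt h i)
  rest-same : rest f ≡ rest g
  rest-same = sum-cong-≗ (λ j → same (punchIn i j) (punchInᵢ≢i i j))

<⇒≡+suc : ∀ {m n} → m < n → ∃ λ b → n ≡ m + suc b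
<⇒≡+suc {zero}  {suc n} _         = n , refl
<⇒≡+suc {suc m} {suc n} (s≤s m<n) = let b , eq = <⇒≡+suc m<n in b , cong suc eq

<-<-split : ∀ {i j k} → i < j → j < k → ∃₂ λ a b → j ≡ i + suc a × k ≡ i + (suc a + suc b)
<-<-split {zero}  {suc a} _ j<k = let b , eq = <⇒≡+suc j<k in a , b , refl , eq
<-<-split {suc i} {suc j} {suc k} (s≤s i<j) (s≤s j<k) =
  let a , b , j≡ , k≡ = <-<-split i<j j<k in a , b , cong suc j≡ , cong suc k≡

module _ {V : Set} {R : V → V → Set} where

  vertex : ∀ {u v k} → Walk R u v k → ℕ → V
  vertex {u = u} _          zero    = u
  vertex {u = u} here       (suc _) = u
  vertex         (step _ w) (suc t) = vertex w t

  vertex-last : ∀ {u v k} (w : Walk R u v k) → vertex w k ≡ v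
  vertex-last here       = refl
  vertex-last (step _ w) = vertex-last w

  vertex-adj : ∀ {u v k} (w : Walk R u v k) t → t < k → R (vertex w t) (vertex w (suc t))
  vertex-adj (step a _) zero    _         = a
  vertex-adj (step _ w) (suc t) (s≤s t<k) = vertex-adj w t t<k

  _++ʷ_ : ∀ {u v x j k} → Walk R u v j → Walk R v x k → Walk R u x (j + k)
  here     ++ʷ w′ = w′
  step a w ++ʷ w′ = step a (w ++ʷ w′)

  snocʷ : ∀ {u v x k} → Walk R u v k → R v x → Walk R u x (suc k)
  snocʷ here       e = step e here
  snocʷ (step a w) e = step a (snocʷ w e)

  reverseʷ : Symmetric R → ∀ {u v k} → Walk R u v k → Walk R v u k
  reverseʷ R-sym here       = here
  reverseʷ R-sym (step a w) = snocʷ (reverseʷ R-sym w) (R-sym a)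

  takeʷ : ∀ i {j u v} (w : Walk R u v (i + j)) → Walk R u (vertex w i) i
  takeʷ zero    w          = here
  takeʷ (suc i) (step a w) = step a (takeʷ i w)

  dropʷ : ∀ i {j u v} (w : Walk R u v (i + j)) → Walk R (vertex w i) v j
  dropʷ zero    w          = w
  dropʷ (suc i) (step _ w) = dropʷ i w

  vertex-dropʷ : ∀ i {j u v} (w : Walk R u v (i + j)) t → vertex (dropʷ i w) t ≡ vertex w (i + t)
  vertex-dropʷ zero    w          t = refl
  vertex-dropʷ (suc i) (step _ w) t = vertex-dropʷ i w t

  cutLoop : ∀ i a {b u v} (w : Walk R u v (i + (a + b))) → vertex w (i + a) ≡ vertex w i →
            Walk R u v (i + b) × Walk R (vertex w i) (vertex w i) a
  cutLoop i a {b} {v = v} w loop =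
      takeʷ i w ++ʷ subst (λ x → Walk R x v b) back (dropʷ a (dropʷ i w))
    , subst (λ x → Walk R (vertex w i) x a) back (takeʷ a (dropʷ i w))
    where
    back : vertex (dropʷ i w) a ≡ vertex w i
    back = trans (vertex-dropʷ i w a) loop

  -- Only positions 0 … k-1 are compared, so the shared endpoint of a closed
  -- walk does not count as a repetition.
  HasRepeat : ∀ {u v k} → Walk R u v k → Set
  HasRepeat {k = k} w = ∃ λ j → j < k × ∃ λ i → i < j × vertex w i ≡ vertex w j

  hasRepeat? : DecidableEquality V → ∀ {u v k} (w : Walk R u v k) → Dec (HasRepeat w)
  hasRepeat? _≟ᵥ_ {k = k} w =
    anyUpTo? (λ j → anyUpTo? (λ i → vertex w i ≟ᵥ vertex w j) j) k

  splitAtRepeat : ∀ {u v k} (w : Walk R u v k) → HasRepeat w →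
    ∃₂ λ l m → l < k × m < k × l + m ≡ k × Walk R u v l × ∃ λ x → Walk R x x m
  splitAtRepeat w (j , j<k , i , i<j , repeat) with <-<-split i<j j<k
  ... | a , b , refl , refl =
    let shorter , loop = cutLoop i (suc a) w (sym repeat)
    in  i + suc b , suc a , +-monoʳ-< i (m<n+m (suc b) (s≤s z≤n))
      , <-≤-trans (m<m+n (suc a) (s≤s z≤n)) (m≤n+m _ i) , lengths , shorter , _ , loop
    where
    lengths : i + suc b + suc a ≡ i + (suc a + suc b)
    lengths = trans (+-assoc i (suc b) (suc a)) (cong (i +_) (+-comm (suc b) (suc a)))

module _ (G : Graph) where

  closedWalk⇒cycle : ∀ {k u} (w : Walk (Adj G) u u (3 + k)) → ¬ HasRepeat w → Cycle G
  closedWalk⇒cycle {k} w distinct =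
    record { k = k ; f = f ; inj = inj ; edges = edges ; close = close }
    where
    f : Fin (3 + k) → Fin (n G)
    f t = vertex w (toℕ t)

    inj : ∀ {x y} → f x ≡ f y → x ≡ y
    inj {x} {y} fx≡fy with <-cmp (toℕ x) (toℕ y)
    ... | tri< x<y _ _ = ⊥-elim (distinct (toℕ y , toℕ<n y , toℕ x , x<y , fx≡fy))
    ... | tri≈ _ x≡y _ = toℕ-injective x≡y
    ... | tri> _ _ y<x = ⊥-elim (distinct (toℕ x , toℕ<n x , toℕ y , y<x , sym fx≡fy))

    edges : ∀ (i : Fin (2 + k)) → Adj G (f (inject₁ i)) (f (suc i))
    edges i rewrite toℕ-inject₁ i = vertex-adj w (toℕ i) (m<n⇒m<1+n (toℕ<n i))

    close : Adj G (f (fromℕ (2 + k))) (f zero)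
    close rewrite toℕ-fromℕ (2 + k) = subst (Adj G _) (vertex-last w) (vertex-adj w (2 + k) ≤-refl)

  acyclic⇒closedWalk-even : Acyclic G → ∀ {k u} → Walk (Adj G) u u k → parity k ≡ 0ℙ
  acyclic⇒closedWalk-even acyclic {k} = <-rec EvenClosedWalks even k
    where
    EvenClosedWalks : ℕ → Set
    EvenClosedWalks k = ∀ {u} → Walk (Adj G) u u k → parity k ≡ 0ℙ

    even : ∀ k → (∀ {l} → l < k → EvenClosedWalks l) → EvenClosedWalks k
    even k ih w with hasRepeat? _≟_ w
    ... | yes repeat =
      let l , m , l<k , m<k , l+m≡k , shorter , _ , loop = splitAtRepeat w repeat
      in  begin
            parity k                ≡⟨ cong parity (sym l+m≡k) ⟩
            parity (l + m)          ≡⟨ ℙ.+-homo-+ l m ⟩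
            parity l ⊕ parity m     ≡⟨ cong₂ _⊕_ (ih l<k shorter) (ih m<k loop) ⟩
            0ℙ                      ∎
    even _ _ here                           | no _        = refl
    even _ _ (step a here)                  | no _        = ⊥-elim (irrefl G a)
    even _ _ (step _ (step _ here))         | no _        = refl
    even _ _ w@(step _ (step _ (step _ _))) | no distinct = ⊥-elim (acyclic (closedWalk⇒cycle w distinct))

ParityColouring : {V : Set} → (V → V → Set) → (V → Parity) → Set
ParityColouring R colour = ∀ {x y} → R x y → colour x ⊕ colour y ≡ 1ℙ

Bipartite : {V : Set} → (V → V → Set) → Set
Bipartite {V} R = Σ (V → Parity) (ParityColouring R)

module _ (G : Graph) where

  connected⇒bipartite : Fin (n G) → Connected G →
    (∀ {k u} → Walk (Adj G) u u k → parity k ≡ 0ℙ) → Bipartite (Adj G)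
  connected⇒bipartite root connected even = depthParity , proper
    where
    depthParity : Fin (n G) → Parity
    depthParity v = parity (proj₁ (connected root v))

    proper : ParityColouring (Adj G) depthParity
    proper {u} {v} u~v with connected root u | connected root v
    ... | a , root⇝u | b , root⇝v = ℙ.⁻¹-injective (begin
      (parity a ⊕ parity b) ⁻¹    ≡⟨ x∙yz≈y∙xz 1ℙ (parity a) (parity b) ⟩
      parity a ⊕ (1ℙ ⊕ parity b)  ≡⟨ cong (parity a ⊕_) (sym (ℙ.+-homo-+ 1 b)) ⟩
      parity a ⊕ parity (suc b)   ≡⟨ sym (ℙ.+-homo-+ a (suc b)) ⟩
      parity (a + suc b)          ≡⟨ even (root⇝u ++ʷ step u~v (reverseʷ (Graph.sym G) root⇝v)) ⟩
      0ℙ                          ∎)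

tree⇒bipartite : ∀ G → IsTree G → Bipartite (Adj G)
tree⇒bipartite G (nonempty , connected , acyclic) =
  connected⇒bipartite G (fromℕ< nonempty) connected (acyclic⇒closedWalk-even G acyclic)

module _ {d : ℕ} {T : Fin d → Graph} where

  prodAdj-sym : Symmetric (ProdAdj d T)
  prodAdj-sym (i , a , same) = i , Graph.sym (T i) a , λ j j≢i → sym (same j j≢i)

  product-bipartite : (∀ i → Bipartite (Adj (T i))) → Bipartite (ProdAdj d T)
  product-bipartite bipartite = colour , proper
    where
    colour : ProdV d T → Parity
    colour x = sum λ i → proj₁ (bipartite i) (x i)

    proper : ParityColouring (ProdAdj d T) colour
    proper (i , xᵢ~yᵢ , same) =
      sum-differAt _ _ i (proj₂ (bipartite i) xᵢ~yᵢ) (λ j j≢i → cong (proj₁ (bipartite j)) (same j j≢i))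

UnitStep : ℕ → ℕ → Set
UnitStep m n = n ≡ suc m ⊎ m ≡ suc n

≢⇒unitStep : ∀ {m n} → m ≢ n → n ≤ suc m → m ≤ suc n → UnitStep m n
≢⇒unitStep {m} {n} m≢n n≤1+m m≤1+n with <-cmp m n
... | tri< m<n _ _ = inj₁ (≤-antisym n≤1+m m<n)
... | tri≈ _ m≡n _ = ⊥-elim (m≢n m≡n)
... | tri> _ _ n<m = inj₂ (≤-antisym m≤1+n n<m)

module _ {V : Set} {R : V → V → Set} (colour : V → Parity) (proper : ParityColouring R colour) where

  colour-walk : ∀ {u v k} → Walk R u v k → colour u ⊕ colour v ≡ parity k
  colour-walk {u} here = ℙ.p+p≡0ℙ (colour u)
  colour-walk {u} {v} (step {w = x} {k = k} u~x x⇝v) = begin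
    colour u ⊕ colour v                          ≡⟨ sym (x⊕y⊕[y⊕z]≡x⊕z (colour u) (colour x) (colour v)) ⟩
    (colour u ⊕ colour x) ⊕ (colour x ⊕ colour v) ≡⟨ cong₂ _⊕_ (proper u~x) (colour-walk x⇝v) ⟩
    1ℙ ⊕ parity k                                ≡⟨ sym (ℙ.+-homo-+ 1 k) ⟩
    parity (suc k)                               ∎

  dist-unitStep : Symmetric R → ∀ {c u v m n} → IsDist R c u m → IsDist R c v n → R u v → UnitStep m n
  dist-unitStep R-sym {c} {u} {v} {m} {n} (c⇝u , u-minimal) (c⇝v , v-minimal) u~v =
    ≢⇒unitStep m≢n (v-minimal _ (snocʷ c⇝u u~v)) (u-minimal _ (snocʷ c⇝v (R-sym u~v)))
    where
    opposite : parity m ⊕ parity n ≡ 1ℙ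
    opposite = begin
      parity m ⊕ parity n                           ≡⟨ cong₂ _⊕_ (sym (colour-walk c⇝u)) (sym (colour-walk c⇝v)) ⟩
      (colour c ⊕ colour u) ⊕ (colour c ⊕ colour v) ≡⟨ cong (_⊕ (colour c ⊕ colour v)) (ℙ.+-comm (colour c) (colour u)) ⟩
      (colour u ⊕ colour c) ⊕ (colour c ⊕ colour v) ≡⟨ x⊕y⊕[y⊕z]≡x⊕z (colour u) (colour c) (colour v) ⟩
      colour u ⊕ colour v                           ≡⟨ proper u~v ⟩
      1ℙ                                            ∎

    m≢n : m ≢ n
    m≢n refl with trans (sym (ℙ.p+p≡0ℙ (parity m))) opposite
    ... | ()

n<ᵇ1+n : ∀ n → (n <ᵇ suc n) ≡ true
n<ᵇ1+n zero    = refl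
n<ᵇ1+n (suc n) = n<ᵇ1+n n

1+n≮ᵇn : ∀ n → (suc n <ᵇ n) ≡ false
1+n≮ᵇn zero    = refl
1+n≮ᵇn (suc n) = 1+n≮ᵇn n

unitStep-balance : ∀ {m n} → UnitStep m n → n + 2 * (if n <ᵇ m then 1 else 0) ≡ m + 1
unitStep-balance {m} (inj₁ refl) rewrite 1+n≮ᵇn m = sym (+-suc m 0)
unitStep-balance {n = n} (inj₂ refl) rewrite n<ᵇ1+n n = +-suc n 1

last+2*towardCount≡first+s : ∀ s (D : Fin (suc s) → ℕ) → (∀ i → UnitStep (D (inject₁ i)) (D (suc i))) →
                             D (fromℕ s) + 2 * towardCount s D ≡ D zero + s
last+2*towardCount≡first+s zero    D _     = refl
last+2*towardCount≡first+s (suc s) D steps = begin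
  D (fromℕ (suc s)) + 2 * (δ + t)   ≡⟨ shuffle (D (fromℕ (suc s))) δ t ⟩
  D (fromℕ (suc s)) + 2 * t + 2 * δ ≡⟨ cong (_+ 2 * δ) (last+2*towardCount≡first+s s (D ∘ suc) (steps ∘ suc)) ⟩
  D (suc zero) + s + 2 * δ          ≡⟨ swap (D (suc zero)) s (2 * δ) ⟩
  D (suc zero) + 2 * δ + s          ≡⟨ cong (_+ s) (unitStep-balance (steps zero)) ⟩
  D zero + 1 + s                    ≡⟨ +-assoc (D zero) 1 s ⟩
  D zero + suc s                    ∎
  where
  δ t : ℕ
  δ = if D (suc zero) <ᵇ D zero then 1 else 0
  t = towardCount s (D ∘ suc)
  shuffle : ∀ a b c → a + 2 * (b + c) ≡ a + 2 * c + 2 * b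
  shuffle = solve-∀
  swap : ∀ a b c → a + b + c ≡ a + c + b
  swap = solve-∀

towardCount-small⇒far : ∀ s (D : Fin (suc s) → ℕ) → (∀ i → UnitStep (D (inject₁ i)) (D (suc i))) →
                        2 * towardCount s D < D zero → s < D (fromℕ s)
towardCount-small⇒far s D steps 2m<D₀ =
  +-cancelˡ-< (D zero) s (D (fromℕ s))
    (subst₂ _<_ (last+2*towardCount≡first+s s D steps) (+-comm (D (fromℕ s)) (D zero))
      (+-monoʳ-< (D (fromℕ s)) 2m<D₀))

lemma3p8 : (s d : ℕ) → 2 ≤ s → 1 ≤ d →
    (T : Fin d → Graph) → (∀ i → IsTree (T i)) →
    (c r : ProdV d T) → r ≢ c →
    (ρ : Fin (suc s) → ProdV d T) → ρ zero ≡ r →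
    (∀ (i : Fin s) → ProdAdj d T (ρ (inject₁ i)) (ρ (suc i))) →
    (D : Fin (suc s) → ℕ) →
    (∀ i → IsDist (ProdAdj d T) c (ρ i) (D i)) →
    2 * towardCount s D < D zero →
    s < D (fromℕ s)
lemma3p8 s d _ _ T trees _ _ _ _ _ moves D dist 2m<D₀ = towardCount-small⇒far s D steps 2m<D₀
  where
  G-bipartite : Bipartite (ProdAdj d T)
  G-bipartite = product-bipartite {T = T} λ i → tree⇒bipartite (T i) (trees i)

  steps : ∀ i → UnitStep (D (inject₁ i)) (D (suc i))
  steps i = dist-unitStep (proj₁ G-bipartite) (proj₂ G-bipartite) (prodAdj-sym {T = T})
                          (dist (inject₁ i)) (dist (suc i)) (moves i)
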